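{- Let $G$ be a double tree, $(T_1,T_2)$ a spanning tree factorization of $G$ and $x \in V(G)$ such that $x$ is incident to a unique edge $e$ in $T_1$. Then for any tree-mapping function $\sigma:E(T_1)\rightarrow E(T_2)$, we have $\sigma(e)\in \delta_G(x)$.
   Context: Graphs are finite and may have parallel edges. A double tree is a graph $G$ having two edge-disjoint spanning trees $T_1,T_2$ with $E(T_1)\cup E(T_2)=E(G)$; such a pair $(T_1,T_2)$ is a spanning tree factorization of $G$. A tree-mapping function from $T_1$ to $T_2$ is a function $\sigma:E(T_1)\to E(T_2)$ such that for every $e\in E(T_1)$, $(T_1-e+\sigma(e),\,T_2-\sigma(e)+e)$ is a spanning tree factorization of $G$. $\delta_G(x)$ is the set of edges of $G$ incident to $x$ (linking $x$ to another vertex). -}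

module Defs where

open import Data.Nat using (ℕ; suc)
open import Data.Fin using (Fin)
open import Data.Fin.Subset using (Subset; _∈_; _∉_; inside; outside)
open import Data.Vec using (_[_]≔_)
open import Data.List using (List; []; _∷_)
open import Data.List.Relation.Unary.Unique.Propositional using (Unique)
open import Data.Product using (Σ; _×_; _,_; proj₁; proj₂)
open import Data.Sum using (_⊎_)
open import Data.Empty using (⊥)
open import Relation.Nullary using (¬_)
open import Relation.Binary.PropositionalEquality using (_≡_)

-- A finite multigraph (parallel edges and loops allowed):
-- vertices Fin n, edges Fin m, each edge has an (unordered) pair of ends.
record Graph : Set where
  field
    n    : ℕ
    m    : ℕ
    ends : Fin m → Fin n × Fin n

module _ (G : Graph) where
  open Graph G

  V : Set
  V = Fin n

  E : Set
  E = Fin m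

  EdgeSet : Set
  EdgeSet = Subset m

  Joins : E → V → V → Set
  Joins e u w = (ends e ≡ (u , w)) ⊎ (ends e ≡ (w , u))

  Incident : E → V → Set
  Incident e x = (proj₁ (ends e) ≡ x) ⊎ (proj₂ (ends e) ≡ x)

  δ : V → E → Set
  δ x e = Incident e x × ¬ (proj₁ (ends e) ≡ proj₂ (ends e))

  data Walk (S : EdgeSet) : V → V → Set where
    [] : ∀ {v} → Walk S v v
    step : ∀ {u w v} (e : E) → e ∈ S → Joins e u w → Walk S w v → Walk S u v

  walkEdges : ∀ {S u v} → Walk S u v → List E
  walkEdges [] = []
  walkEdges (step e _ _ p) = e ∷ walkEdges p

  -- the vertices at which the walk's steps start (the final vertex omitted)
  walkStarts : ∀ {S u v} → Walk S u v → List V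
  walkStarts [] = []
  walkStarts (step {u = u} e _ _ p) = u ∷ walkStarts p

  NonEmpty : ∀ {S u v} → Walk S u v → Set
  NonEmpty [] = ⊥
  NonEmpty (step _ _ _ _) = Data.Unit.⊤
    where import Data.Unit

  IsCycle : ∀ {S v} → Walk S v v → Set
  IsCycle p = NonEmpty p × Unique (walkEdges p) × Unique (walkStarts p)

  Connected : EdgeSet → Set
  Connected S = ∀ (u v : V) → Walk S u v

  Acyclic : EdgeSet → Set
  Acyclic S = ∀ (v : V) (p : Walk S v v) → ¬ IsCycle p

  IsSpanningTree : EdgeSet → Set
  IsSpanningTree S = Connected S × Acyclic S

  IsFactorization : EdgeSet → EdgeSet → Set
  IsFactorization T₁ T₂ =
    IsSpanningTree T₁ × IsSpanningTree T₂ ×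
    (∀ (e : E) → ¬ (e ∈ T₁ × e ∈ T₂)) ×
    (∀ (e : E) → e ∈ T₁ ⊎ e ∈ T₂)

  -- S - e + f
  swap : EdgeSet → E → E → EdgeSet
  swap S e f = (S [ e ]≔ outside) [ f ]≔ inside

  IsTreeMapping : (T₁ T₂ : EdgeSet) →
    (Σ E (_∈ T₁) → Σ E (_∈ T₂)) → Set
  IsTreeMapping T₁ T₂ σ =
    ∀ (e : E) (e∈ : e ∈ T₁) →
      let f = proj₁ (σ (e , e∈)) in
      IsFactorization (swap T₁ e f) (swap T₂ f e)

-- Removing e from T₁ leaves x without incident edges, so the connected graph T₁ - e + σ(e)
-- can only reach x through σ(e); and σ(e) is not a loop because it lies in an acyclic graph.
module Submission where

open import Defs
open import Data.Empty using (⊥-elim)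
open import Data.Fin using (Fin; _≟_)
open import Data.Fin.Subset using (Side; Subset; _∈_; _∉_; outside)
open import Data.List.Relation.Unary.All using ([])
open import Data.List.Relation.Unary.AllPairs using ([]; _∷_)
open import Data.Nat using (ℕ)
open import Data.Product using (Σ; ∃-syntax; _×_; _,_; proj₁; proj₂)
open import Data.Sum using (_⊎_; inj₁; inj₂)
open import Data.Unit using (tt)
open import Data.Vec using (_[_]≔_)
open import Data.Vec.Properties using ([]=⇒lookup; lookup⇒[]=; lookup∘update; lookup∘update′; []≔-updates)
open import Relation.Nullary using (¬_; yes; no)
open import Relation.Binary.PropositionalEquality using (_≡_; _≢_; refl; sym; trans; cong; subst)

module _ {k : ℕ} where

  ∉-[]≔-outside : (p : Subset k) (i : Fin k) → i ∉ p [ i ]≔ outside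
  ∉-[]≔-outside p i i∈ with trans (sym (lookup∘update i p outside)) ([]=⇒lookup i∈)
  ... | ()

  ∈-[]≔⁻ : (p : Subset k) {i j : Fin k} (b : Side) → i ≢ j → i ∈ p [ j ]≔ b → i ∈ p
  ∈-[]≔⁻ p b i≢j i∈ =
    lookup⇒[]= _ p (trans (sym (lookup∘update′ i≢j p b)) ([]=⇒lookup i∈))

module _ (G : Graph) where
  open Graph G

  IsLoop : E G → Set
  IsLoop h = proj₁ (ends h) ≡ proj₂ (ends h)

  ∈-swap : (S : EdgeSet G) (e f : E G) → f ∈ swap G S e f
  ∈-swap S e f = []≔-updates (S [ e ]≔ outside) f

  ∈-swap⁻ : (S : EdgeSet G) (e f : E G) {g : E G} →
            g ∈ swap G S e f → g ≡ f ⊎ (g ∈ S × g ≢ e)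
  ∈-swap⁻ S e f {g} g∈ with g ≟ f
  ... | yes g≡f = inj₁ g≡f
  ... | no g≢f with g ≟ e
  ...   | yes refl = ⊥-elim (∉-[]≔-outside S g (∈-[]≔⁻ (S [ e ]≔ outside) _ g≢f g∈))
  ...   | no g≢e = inj₂ (∈-[]≔⁻ S _ g≢e (∈-[]≔⁻ (S [ e ]≔ outside) _ g≢f g∈) , g≢e)

  acyclic⇒loopless : {S : EdgeSet G} → Acyclic G S → {h : E G} → h ∈ S → ¬ IsLoop h
  acyclic⇒loopless ac {h} h∈ loop =
    ac u (step h h∈ (inj₁ (cong (u ,_) (sym loop))) []) (tt , [] ∷ [] , [] ∷ [])
    where u = proj₁ (ends h)

  walk⇒incident-edge : {S : EdgeSet G} {u v : V G} → Walk G S u v → u ≢ v →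
                       ∃[ g ] g ∈ S × Incident G g u
  walk⇒incident-edge []                       u≢u = ⊥-elim (u≢u refl)
  walk⇒incident-edge (step g g∈ (inj₁ eq) _) _   = g , g∈ , inj₁ (cong proj₁ eq)
  walk⇒incident-edge (step g g∈ (inj₂ eq) _) _   = g , g∈ , inj₂ (cong proj₂ eq)

  -- The other end of a non-loop edge at x is a vertex distinct from x, and S must reach it.
  connected⇒incident-edge : {S : EdgeSet G} → Connected G S →
                            {h : E G} {x : V G} → Incident G h x → ¬ IsLoop h →
                            ∃[ g ] g ∈ S × Incident G g x
  connected⇒incident-edge conn {h} {x} (inj₁ refl) nl =
    walk⇒incident-edge (conn x (proj₂ (ends h))) nl
  connected⇒incident-edge conn {h} {x} (inj₂ refl) nl =
    walk⇒incident-edge (conn x (proj₁ (ends h))) (λ eq → nl (sym eq))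

proposition4 : (G : Graph) (T₁ T₂ : EdgeSet G) →
    IsFactorization G T₁ T₂ →
    (x : V G) (e : E G) (e∈T₁ : e ∈ T₁) → Incident G e x →
    (∀ (f : E G) → f ∈ T₁ → Incident G f x → f ≡ e) →
    (σ : Σ (E G) (_∈ T₁) → Σ (E G) (_∈ T₂)) → IsTreeMapping G T₁ T₂ σ →
    δ G x (proj₁ (σ (e , e∈T₁)))
proposition4 G T₁ T₂ ((_ , acyclic₁) , _) x e e∈T₁ e∋x unique σ treeMapping =
  f∋x , acyclic⇒loopless G acyclic′ (∈-swap G T₁ e f)
  where
  f = proj₁ (σ (e , e∈T₁))
  connected′ = proj₁ (proj₁ (treeMapping e e∈T₁))
  acyclic′   = proj₂ (proj₁ (treeMapping e e∈T₁))
  f∋x : Incident G f x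
  f∋x with connected⇒incident-edge G connected′ e∋x (acyclic⇒loopless G acyclic₁ e∈T₁)
  ... | g , g∈T′ , g∋x with ∈-swap⁻ G T₁ e f g∈T′
  ...   | inj₁ g≡f          = subst (λ h → Incident G h x) g≡f g∋x
  ...   | inj₂ (g∈T₁ , g≢e) = ⊥-elim (g≢e (unique g g∈T₁ g∋x))
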